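{- Let $I_2$ and $I_3$ be disjoint finite sets, let $q : I_3 \to I_2$ be a map, and let $p \in [0, 1/2]$. Form a random set $S \subseteq I_2 \cup I_3$ as follows: for each $i \in I_2$ independently flip a fair coin; if heads, include $i$ in $S$ with probability $2p$; if tails, include each point of $q^{ -1}(i)$ in $S$ independently with probability $2p$ (all random choices independent). Let $T \subseteq I_3$ be nonempty with $|T| = c$, let $i \in T$ and $i' = q(i)$. Then the probability that no point of $T$ and not $i'$ lies in $S$ is at most $\frac{1}{2}(1-2p) + \frac{1}{2}(1-2p)^c$.
   Formalization: The parameter p takes only rational values in $[0, 1/2]$. -}

module Defs where

open import Data.Nat using (ℕ; zero; suc)
open import Data.Bool using (Bool; true; false; if_then_else_; _∧_; not)
open import Data.Fin using (Fin; zero; suc)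
open import Data.Vec.Functional using (Vector; _∷_)
open import Data.Vec using (lookup)
open import Data.Fin.Subset using (Subset)
open import Data.Rational using (ℚ; 0ℚ; 1ℚ; ½; _+_; _*_; _-_)

_^ℚ_ : ℚ → ℕ → ℚ
r ^ℚ zero = 1ℚ
r ^ℚ suc k = r * (r ^ℚ k)

sumBool : (k : ℕ) → ((Fin k → Bool) → ℚ) → ℚ
sumBool zero f = f (λ ())
sumBool (suc k) f = sumBool k (λ g → f (true ∷ g)) + sumBool k (λ g → f (false ∷ g))

prodFin : (k : ℕ) → (Fin k → ℚ) → ℚ
prodFin zero f = 1ℚ
prodFin (suc k) f = f zero * prodFin k (λ j → f (suc j))

allFin : (k : ℕ) → (Fin k → Bool) → Bool
allFin zero f = true
allFin (suc k) f = f zero ∧ allFin k (λ j → f (suc j))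

bern : ℚ → Bool → ℚ
bern r true = r
bern r false = 1ℚ - r

-- The random set S ⊆ I₂ ⊎ I₃ with I₂ = Fin n, I₃ = Fin m, q : Fin m → Fin n.
-- Outcome: coin : Fin n → Bool (true = heads, fair), and independent
-- Bernoulli(2p) bits b₂ : Fin n → Bool, b₃ : Fin m → Bool.
-- j ∈ I₂ is in S iff coin j is heads and b₂ j;
-- k ∈ I₃ is in S iff coin (q k) is tails and b₃ k.
inS₂ : {n : ℕ} → (Fin n → Bool) → (Fin n → Bool) → Fin n → Bool
inS₂ coin b₂ j = coin j ∧ b₂ j

inS₃ : {n m : ℕ} → (Fin m → Fin n) → (Fin n → Bool) → (Fin m → Bool) → Fin m → Bool
inS₃ q coin b₃ k = not (coin (q k)) ∧ b₃ k

weight : (n m : ℕ) → ℚ → (Fin n → Bool) → (Fin n → Bool) → (Fin m → Bool) → ℚ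
weight n m p coin b₂ b₃ =
  prodFin n (λ _ → ½) * (prodFin n (λ j → bern (p + p) (b₂ j)) * prodFin m (λ k → bern (p + p) (b₃ k)))

Pr : (n m : ℕ) → ℚ → ((Fin n → Bool) → (Fin n → Bool) → (Fin m → Bool) → Bool) → ℚ
Pr n m p E =
  sumBool n (λ coin → sumBool n (λ b₂ → sumBool m (λ b₃ →
    weight n m p coin b₂ b₃ * (if E coin b₂ b₃ then 1ℚ else 0ℚ))))

avoidEvent : {n m : ℕ} → (Fin m → Fin n) → Subset m → Fin n →
             (Fin n → Bool) → (Fin n → Bool) → (Fin m → Bool) → Bool
avoidEvent {n} {m} q T i' coin b₂ b₃ =
  not (inS₂ coin b₂ i') ∧ allFin m (λ k → not (lookup T k ∧ inS₃ q coin b₃ k))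

{-# OPTIONS --safe #-}
-- Condition on the fair coins. Given them, every point of T ∪ {i′} stays out of S
-- independently, with probability r = 1 - 2p if its coin makes it eligible and 1
-- otherwise. Pair each coin outcome with its complement and let X, Y be the two
-- products over T. Every point of T is eligible in exactly one of the two, so
-- X Y = r^c; i′ = q i is eligible in one outcome and i in the other, so the pair
-- contributes r X + Y with Y ≤ r (or symmetrically), and
-- r X + Y ≤ r + X Y = r + r^c because (1 - X)(r - Y) ≥ 0. Averaging over pairs gives
-- the bound.
module Submission where

open import Defs
open import Data.Nat using (ℕ; zero; suc)
open import Data.Fin using (Fin; zero; suc)
open import Data.Fin.Subset using (Subset; _∈_; ∣_∣; Nonempty)
open import Data.Rational using (ℚ; 0ℚ; 1ℚ; ½; _+_; _*_; _-_; -_; _≤_; nonNegative)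
open import Relation.Binary.PropositionalEquality
  using (_≡_; refl; sym; trans; cong; cong₂; module ≡-Reasoning)

open import Data.Bool using (Bool; true; false; if_then_else_; _∧_; not)
open import Data.Product using (_×_; _,_; proj₁; proj₂)
open import Data.Vec using ([]; _∷_; lookup)
import Data.Vec.Functional as Vector
open import Data.Vec.Properties using ([]=⇒lookup)
open import Data.Rational.Properties
  using (≤-refl; ≤-reflexive; ≤-trans; module ≤-Reasoning; +-mono-≤; +-monoˡ-≤; +-monoʳ-≤;
         +-identityʳ; +-inverseʳ; +-comm; *-assoc; *-comm; *-identityˡ; *-identityʳ; *-zeroˡ; *-distribˡ-+;
         neg-antimono-≤; *-monoˡ-≤-nonNeg; *-monoʳ-≤-nonNeg; nonNeg*nonNeg⇒nonNeg; nonNegative⁻¹)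
open import Data.Rational.Solver using (module +-*-Solver)
open +-*-Solver using (solve; _:+_; _:-_; _:*_; _:=_; con)

ind : Bool → ℚ
ind b = if b then 1ℚ else 0ℚ

ind-∧ : ∀ a b → ind (a ∧ b) ≡ ind a * ind b
ind-∧ true  b = sym (*-identityˡ (ind b))
ind-∧ false b = sym (*-zeroˡ (ind b))

ind-allFin : ∀ k (u : Fin k → Bool) → ind (allFin k u) ≡ prodFin k (λ j → ind (u j))
ind-allFin zero    u = refl
ind-allFin (suc k) u = trans (ind-∧ (u zero) _) (cong (ind (u zero) *_) (ind-allFin k (λ j → u (suc j))))

p≤q⇒0≤q-p : ∀ {p q} → p ≤ q → 0ℚ ≤ q - p
p≤q⇒0≤q-p {p} {q} p≤q = ≤-trans (≤-reflexive (sym (+-inverseʳ p))) (+-monoˡ-≤ (- p) p≤q)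

p≤p+q : ∀ {p q} → 0ℚ ≤ q → p ≤ p + q
p≤p+q {p} {q} 0≤q = ≤-trans (≤-reflexive (sym (+-identityʳ p))) (+-monoʳ-≤ p 0≤q)

0≤p*q : ∀ {p q} → 0ℚ ≤ p → 0ℚ ≤ q → 0ℚ ≤ p * q
0≤p*q {p} {q} 0≤p 0≤q =
  nonNegative⁻¹ (p * q) {{nonNeg*nonNeg⇒nonNeg p {{nonNegative 0≤p}} q {{nonNegative 0≤q}}}}

rx+y≤r+xy : ∀ {r x y} → x ≤ 1ℚ → y ≤ r → r * x + y ≤ r + x * y
rx+y≤r+xy {r} {x} {y} x≤1 y≤r = begin
  r * x + y                         ≤⟨ p≤p+q (0≤p*q (p≤q⇒0≤q-p x≤1) (p≤q⇒0≤q-p y≤r)) ⟩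
  r * x + y + (1ℚ - x) * (r - y)   ≡⟨ solve 3 (λ r x y → r :* x :+ y :+ (con 1ℚ :- x) :* (r :- y)
                                                   := r :+ x :* y) refl r x y ⟩
  r + x * y                         ∎
  where open ≤-Reasoning

InUnit : ℚ → Set
InUnit x = 0ℚ ≤ x × x ≤ 1ℚ

1-InUnit : ∀ {s} → InUnit s → InUnit (1ℚ - s)
1-InUnit (0≤s , s≤1) = p≤q⇒0≤q-p s≤1 , +-monoʳ-≤ 1ℚ (neg-antimono-≤ 0≤s)

*-InUnit : ∀ {x y} → InUnit x → InUnit y → InUnit (x * y)
*-InUnit {x} {y} (0≤x , x≤1) (0≤y , y≤1) =
  0≤p*q 0≤x 0≤y ,
  ≤-trans (*-monoˡ-≤-nonNeg x {{nonNegative 0≤x}} y≤1) (≤-trans (≤-reflexive (*-identityʳ x)) x≤1)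

prodFin-cong : ∀ k {f g : Fin k → ℚ} → (∀ j → f j ≡ g j) → prodFin k f ≡ prodFin k g
prodFin-cong zero    f≡g = refl
prodFin-cong (suc k) f≡g = cong₂ _*_ (f≡g zero) (prodFin-cong k (λ j → f≡g (suc j)))

prodFin-* : ∀ k (f g : Fin k → ℚ) → prodFin k f * prodFin k g ≡ prodFin k (λ j → f j * g j)
prodFin-* zero    f g = *-identityˡ 1ℚ
prodFin-* (suc k) f g = trans
  (solve 4 (λ a x b y → (a :* x) :* (b :* y) := (a :* b) :* (x :* y)) refl
     (f zero) (prodFin k (λ j → f (suc j))) (g zero) (prodFin k (λ j → g (suc j))))
  (cong (f zero * g zero *_) (prodFin-* k (λ j → f (suc j)) (λ j → g (suc j))))

prodFin-InUnit : ∀ k {f : Fin k → ℚ} → (∀ j → InUnit (f j)) → InUnit (prodFin k f)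
prodFin-InUnit zero    f∈I = nonNegative⁻¹ 1ℚ , ≤-refl
prodFin-InUnit (suc k) f∈I = *-InUnit (f∈I zero) (prodFin-InUnit k (λ j → f∈I (suc j)))

prodFin-≤-factor : ∀ k {f : Fin k → ℚ} → (∀ j → InUnit (f j)) → ∀ i → prodFin k f ≤ f i
prodFin-≤-factor (suc k) {f} f∈I zero = begin
  f zero * prodFin k (λ j → f (suc j))  ≤⟨ *-monoˡ-≤-nonNeg (f zero) {{nonNegative 0≤f₀}} P≤1 ⟩
  f zero * 1ℚ                           ≡⟨ *-identityʳ (f zero) ⟩
  f zero                                ∎
  where
  open ≤-Reasoning
  0≤f₀ : 0ℚ ≤ f zero
  0≤f₀ = proj₁ (f∈I zero)
  P≤1 : prodFin k (λ j → f (suc j)) ≤ 1ℚ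
  P≤1 = proj₂ (prodFin-InUnit k (λ j → f∈I (suc j)))
prodFin-≤-factor (suc k) {f} f∈I (suc i) = begin
  f zero * P  ≤⟨ *-monoʳ-≤-nonNeg P {{nonNegative 0≤P}} f₀≤1 ⟩
  1ℚ * P      ≡⟨ *-identityˡ P ⟩
  P           ≤⟨ prodFin-≤-factor k (λ j → f∈I (suc j)) i ⟩
  f (suc i)   ∎
  where
  open ≤-Reasoning
  P : ℚ
  P = prodFin k (λ j → f (suc j))
  f₀≤1 : f zero ≤ 1ℚ
  f₀≤1 = proj₂ (f∈I zero)
  0≤P : 0ℚ ≤ P
  0≤P = proj₁ (prodFin-InUnit k (λ j → f∈I (suc j)))

prodFin-if : ∀ {k} r (T : Subset k) → prodFin k (λ j → if lookup T j then r else 1ℚ) ≡ r ^ℚ ∣ T ∣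
prodFin-if r []          = refl
prodFin-if r (true  ∷ T) = cong (r *_) (prodFin-if r T)
prodFin-if r (false ∷ T) = trans (*-identityˡ _) (prodFin-if r T)

sumBool-cong : ∀ k {f g : (Fin k → Bool) → ℚ} → (∀ b → f b ≡ g b) → sumBool k f ≡ sumBool k g
sumBool-cong zero    f≡g = f≡g _
sumBool-cong (suc k) f≡g = cong₂ _+_ (sumBool-cong k (λ b → f≡g _)) (sumBool-cong k (λ b → f≡g _))

sumBool-mono-≤ : ∀ k {f g : (Fin k → Bool) → ℚ} → (∀ b → f b ≤ g b) → sumBool k f ≤ sumBool k g
sumBool-mono-≤ zero    f≤g = f≤g _
sumBool-mono-≤ (suc k) f≤g = +-mono-≤ (sumBool-mono-≤ k (λ b → f≤g _)) (sumBool-mono-≤ k (λ b → f≤g _))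

sumBool-*ˡ : ∀ k c (f : (Fin k → Bool) → ℚ) → sumBool k (λ b → c * f b) ≡ c * sumBool k f
sumBool-*ˡ zero    c f = refl
sumBool-*ˡ (suc k) c f = trans
  (cong₂ _+_ (sumBool-*ˡ k c (λ b → f (true Vector.∷ b))) (sumBool-*ˡ k c (λ b → f (false Vector.∷ b))))
  (sym (*-distribˡ-+ c _ _))

sumBool-+ : ∀ k (f g : (Fin k → Bool) → ℚ) → sumBool k (λ b → f b + g b) ≡ sumBool k f + sumBool k g
sumBool-+ zero    f g = refl
sumBool-+ (suc k) f g = trans
  (cong₂ _+_ (sumBool-+ k (λ b → f (true Vector.∷ b)) (λ b → g (true Vector.∷ b)))
             (sumBool-+ k (λ b → f (false Vector.∷ b)) (λ b → g (false Vector.∷ b))))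
  (solve 4 (λ a b c d → (a :+ b) :+ (c :+ d) := (a :+ c) :+ (b :+ d)) refl
     (sumBool k (λ b → f (true Vector.∷ b))) (sumBool k (λ b → g (true Vector.∷ b)))
     (sumBool k (λ b → f (false Vector.∷ b))) (sumBool k (λ b → g (false Vector.∷ b))))

sumBool-*-sumBool : ∀ k l (f : (Fin k → Bool) → ℚ) (g : (Fin l → Bool) → ℚ) →
                    sumBool k (λ a → sumBool l (λ b → f a * g b)) ≡ sumBool k f * sumBool l g
sumBool-*-sumBool k l f g = begin
  sumBool k (λ a → sumBool l (λ b → f a * g b))  ≡⟨ sumBool-cong k (λ a → sumBool-*ˡ l (f a) g) ⟩
  sumBool k (λ a → f a * G)                       ≡⟨ sumBool-cong k (λ a → *-comm (f a) G) ⟩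
  sumBool k (λ a → G * f a)                       ≡⟨ sumBool-*ˡ k G f ⟩
  G * sumBool k f                                 ≡⟨ *-comm G (sumBool k f) ⟩
  sumBool k f * G                                 ∎
  where
  open ≡-Reasoning
  G : ℚ
  G = sumBool l g

-- Without function extensionality, summands must be known to respect pointwise
-- equality of their arguments.
Extensional : ∀ {k} → ((Fin k → Bool) → ℚ) → Set
Extensional {k} F = ∀ b b′ → (∀ j → b j ≡ b′ j) → F b ≡ F b′

sumBool-not : ∀ k (F : (Fin k → Bool) → ℚ) → Extensional F →
              sumBool k F ≡ sumBool k (λ b → F (λ j → not (b j)))
sumBool-not zero    F ext = ext _ _ (λ ())
sumBool-not (suc k) F ext = trans
  (cong₂ _+_ (trans (sumBool-not k (λ b → F (true Vector.∷ b)) (ext-∷ true))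
                    (sumBool-cong k (λ b → ext _ _ (not-∷ false b))))
             (trans (sumBool-not k (λ b → F (false Vector.∷ b)) (ext-∷ false))
                    (sumBool-cong k (λ b → ext _ _ (not-∷ true b)))))
  (+-comm (sumBool k (λ b → F (λ j → not ((false Vector.∷ b) j))))
          (sumBool k (λ b → F (λ j → not ((true Vector.∷ b) j)))))
  where
  ext-∷ : ∀ x → Extensional (λ b → F (x Vector.∷ b))
  ext-∷ x b b′ b≗b′ = ext _ _ λ { zero → refl ; (suc j) → b≗b′ j }
  not-∷ : ∀ x b (j : Fin (suc k)) → (not x Vector.∷ (λ j → not (b j))) j ≡ not ((x Vector.∷ b) j)
  not-∷ x b zero    = refl
  not-∷ x b (suc j) = refl

uniform : ℕ → ℚ
uniform k = prodFin k (λ _ → ½)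

0≤uniform : ∀ k → 0ℚ ≤ uniform k
0≤uniform zero    = nonNegative⁻¹ 1ℚ
0≤uniform (suc k) = 0≤p*q (nonNegative⁻¹ ½) (0≤uniform k)

sumBool-uniform : ∀ k y → sumBool k (λ _ → uniform k * y) ≡ y
sumBool-uniform zero    y = *-identityˡ y
sumBool-uniform (suc k) y = begin
  sumBool k (λ _ → (½ * uniform k) * y) + sumBool k (λ _ → (½ * uniform k) * y)
    ≡⟨ cong (λ z → z + z) (sumBool-cong k (λ _ → regroup)) ⟩
  sumBool k (λ _ → uniform k * (½ * y)) + sumBool k (λ _ → uniform k * (½ * y))
    ≡⟨ cong (λ z → z + z) (sumBool-uniform k (½ * y)) ⟩
  ½ * y + ½ * y
    ≡⟨ solve 1 (λ y → con ½ :* y :+ con ½ :* y := y) refl y ⟩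
  y ∎
  where
  open ≡-Reasoning
  regroup : (½ * uniform k) * y ≡ uniform k * (½ * y)
  regroup = solve 3 (λ h u y → (h :* u) :* y := u :* (h :* y)) refl ½ (uniform k) y

uniform-antipodal-≤ : ∀ k (g : (Fin k → Bool) → ℚ) B → Extensional g →
                      (∀ b → g b + g (λ j → not (b j)) ≤ B) →
                      sumBool k (λ b → uniform k * g b) ≤ ½ * B
uniform-antipodal-≤ k g B ext pair≤B = begin
  S                                                         ≡⟨ solve 1 (λ x → x := con ½ :* (x :+ x)) refl S ⟩
  ½ * (S + S)                                               ≡⟨ cong (λ z → ½ * (S + z)) S≡S̄ ⟩
  ½ * (S + S̄)                                               ≡⟨ cong (½ *_) (sym (sumBool-+ k _ _)) ⟩
  ½ * sumBool k (λ b → uniform k * g b + uniform k * ḡ b)   ≡⟨ cong (½ *_) (sumBool-cong k (λ b →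
                                                                 sym (*-distribˡ-+ (uniform k) (g b) (ḡ b)))) ⟩
  ½ * sumBool k (λ b → uniform k * (g b + ḡ b))             ≤⟨ *-monoˡ-≤-nonNeg ½ (sumBool-mono-≤ k (λ b →
                                                                 *-monoˡ-≤-nonNeg (uniform k) {{nonNegative (0≤uniform k)}}
                                                                   (pair≤B b))) ⟩
  ½ * sumBool k (λ _ → uniform k * B)                       ≡⟨ cong (½ *_) (sumBool-uniform k B) ⟩
  ½ * B                                                     ∎
  where
  open ≤-Reasoning
  ḡ : (Fin k → Bool) → ℚ
  ḡ b = g (λ j → not (b j))
  S S̄ : ℚ
  S = sumBool k (λ b → uniform k * g b)
  S̄ = sumBool k (λ b → uniform k * ḡ b)
  S≡S̄ : S ≡ S̄
  S≡S̄ = sumBool-not k (λ b → uniform k * g b) (λ b b′ b≗b′ → cong (uniform k *_) (ext b b′ b≗b′))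

module Bernoulli (s : ℚ) where

  mean : (Bool → ℚ) → ℚ
  mean φ = s * φ true + (1ℚ - s) * φ false

  mean-const : ∀ c → mean (λ _ → c) ≡ c
  mean-const c = solve 2 (λ s c → s :* c :+ (con 1ℚ :- s) :* c := c) refl s c

  density : (k : ℕ) → (Fin k → Bool) → ℚ
  density k b = prodFin k (λ j → bern s (b j))

  expect : (k : ℕ) → ((Fin k → Bool) → ℚ) → ℚ
  expect k F = sumBool k (λ b → density k b * F b)

  expect-suc : ∀ k F → expect (suc k) F ≡
               s * expect k (λ b → F (true Vector.∷ b)) + (1ℚ - s) * expect k (λ b → F (false Vector.∷ b))
  expect-suc k F = cong₂ _+_ (first-bit s true) (first-bit (1ℚ - s) false)
    where
    first-bit : ∀ w x → sumBool k (λ b → (w * density k b) * F (x Vector.∷ b)) ≡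
                        w * expect k (λ b → F (x Vector.∷ b))
    first-bit w x = trans (sumBool-cong k (λ b → *-assoc w (density k b) _)) (sumBool-*ˡ k w _)

  expect-*ˡ : ∀ k c F → expect k (λ b → c * F b) ≡ c * expect k F
  expect-*ˡ k c F = trans
    (sumBool-cong k (λ b → solve 3 (λ d c f → d :* (c :* f) := c :* (d :* f)) refl (density k b) c (F b)))
    (sumBool-*ˡ k c _)

  expect-const : ∀ k c → expect k (λ _ → c) ≡ c
  expect-const zero    c = *-identityˡ c
  expect-const (suc k) c = trans (expect-suc k (λ _ → c))
    (trans (cong₂ (λ x y → s * x + (1ℚ - s) * y) (expect-const k c) (expect-const k c)) (mean-const c))

  expect-coordinate : ∀ k i (φ : Bool → ℚ) → expect k (λ b → φ (b i)) ≡ mean φ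
  expect-coordinate (suc k) zero    φ = trans (expect-suc k (λ b → φ (b zero)))
    (cong₂ (λ x y → s * x + (1ℚ - s) * y) (expect-const k (φ true)) (expect-const k (φ false)))
  expect-coordinate (suc k) (suc i) φ = trans (expect-suc k (λ b → φ (b (suc i))))
    (trans (cong₂ (λ x y → s * x + (1ℚ - s) * y) (expect-coordinate k i φ) (expect-coordinate k i φ))
           (mean-const (mean φ)))

  expect-prodFin : ∀ k (φ : Fin k → Bool → ℚ) →
                   expect k (λ b → prodFin k (λ j → φ j (b j))) ≡ prodFin k (λ j → mean (φ j))
  expect-prodFin zero    φ = *-identityˡ 1ℚ
  expect-prodFin (suc k) φ = begin
    expect (suc k) (λ b → prodFin (suc k) (λ j → φ j (b j)))
      ≡⟨ expect-suc k (λ b → prodFin (suc k) (λ j → φ j (b j))) ⟩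
    s * expect k (λ b → φ zero true * Φ b) + (1ℚ - s) * expect k (λ b → φ zero false * Φ b)
      ≡⟨ cong₂ (λ x y → s * x + (1ℚ - s) * y) (expect-*ˡ k (φ zero true) Φ) (expect-*ˡ k (φ zero false) Φ) ⟩
    s * (φ zero true * expect k Φ) + (1ℚ - s) * (φ zero false * expect k Φ)
      ≡⟨ solve 4 (λ s t f e → s :* (t :* e) :+ (con 1ℚ :- s) :* (f :* e) := (s :* t :+ (con 1ℚ :- s) :* f) :* e)
               refl s (φ zero true) (φ zero false) (expect k Φ) ⟩
    mean (φ zero) * expect k Φ
      ≡⟨ cong (mean (φ zero) *_) (expect-prodFin k (λ j → φ (suc j))) ⟩
    prodFin (suc k) (λ j → mean (φ j)) ∎
    where
    open ≡-Reasoning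
    Φ : (Fin k → Bool) → ℚ
    Φ b = prodFin k (λ j → φ (suc j) (b j))

  -- The probability that a point stays out of S, given whether its coin makes it eligible.
  escape : Bool → ℚ
  escape x = if x then 1ℚ - s else 1ℚ

  mean-escape : ∀ x → mean (λ b → ind (not (x ∧ b))) ≡ escape x
  mean-escape true  = solve 1 (λ s → s :* con 0ℚ :+ (con 1ℚ :- s) :* con 1ℚ := con 1ℚ :- s) refl s
  mean-escape false = mean-const 1ℚ

  mean-escape-∧ : ∀ t x → mean (λ b → ind (not (t ∧ (x ∧ b)))) ≡ escape (t ∧ x)
  mean-escape-∧ true  x = mean-escape x
  mean-escape-∧ false x = mean-escape false

  escape-InUnit : InUnit s → ∀ x → InUnit (escape x)
  escape-InUnit s∈I true  = 1-InUnit s∈I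
  escape-InUnit s∈I false = nonNegative⁻¹ 1ℚ , ≤-refl

  escape-split : ∀ t x → escape (t ∧ not x) * escape (t ∧ not (not x)) ≡ escape t
  escape-split true  true  = *-identityˡ (1ℚ - s)
  escape-split true  false = *-identityʳ (1ℚ - s)
  escape-split false x     = *-identityˡ 1ℚ

module Coins {n m : ℕ} (q : Fin m → Fin n) (T : Subset m) (s : ℚ) where
  open Bernoulli s

  tailsEscape : (Fin n → Bool) → ℚ
  tailsEscape coin = prodFin m (λ k → escape (lookup T k ∧ not (coin (q k))))

  tailsEscape-ext : Extensional tailsEscape
  tailsEscape-ext coin coin′ coin≗coin′ =
    prodFin-cong m (λ k → cong (λ x → escape (lookup T k ∧ not x)) (coin≗coin′ (q k)))

  tailsEscape-InUnit : InUnit s → ∀ coin → InUnit (tailsEscape coin)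
  tailsEscape-InUnit s∈I coin = prodFin-InUnit m (λ k → escape-InUnit s∈I _)

  tailsEscape-≤ : InUnit s → ∀ {i} coin → lookup T i ≡ true → coin (q i) ≡ false →
                  tailsEscape coin ≤ 1ℚ - s
  tailsEscape-≤ s∈I {i} coin i∈T tails = ≤-trans
    (prodFin-≤-factor m (λ k → escape-InUnit s∈I _) i)
    (≤-reflexive (cong escape (cong₂ _∧_ i∈T (cong not tails))))

  tailsEscape-antipodal : ∀ coin → tailsEscape coin * tailsEscape (λ j → not (coin j)) ≡ (1ℚ - s) ^ℚ ∣ T ∣
  tailsEscape-antipodal coin = trans (prodFin-* m _ _)
    (trans (prodFin-cong m (λ k → escape-split (lookup T k) (coin (q k)))) (prodFin-if (1ℚ - s) T))

  avoid : (Fin n → Bool) → Fin n → ℚ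
  avoid coin i′ = escape (coin i′) * tailsEscape coin

  avoid-ext : ∀ i′ → Extensional (λ coin → avoid coin i′)
  avoid-ext i′ coin coin′ coin≗coin′ =
    cong₂ _*_ (cong escape (coin≗coin′ i′)) (tailsEscape-ext coin coin′ coin≗coin′)

  avoid-antipodal-≤ : InUnit s → ∀ {i} → lookup T i ≡ true → ∀ coin →
                      avoid coin (q i) + avoid (λ j → not (coin j)) (q i) ≤ (1ℚ - s) + (1ℚ - s) ^ℚ ∣ T ∣
  avoid-antipodal-≤ s∈I {i} i∈T coin with coin (q i) in coin-qi
  ... | true  = begin
    (1ℚ - s) * X + 1ℚ * Y  ≡⟨ cong ((1ℚ - s) * X +_) (*-identityˡ Y) ⟩
    (1ℚ - s) * X + Y       ≤⟨ rx+y≤r+xy X≤1 (tailsEscape-≤ s∈I (λ j → not (coin j)) i∈T (cong not coin-qi)) ⟩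
    (1ℚ - s) + X * Y       ≡⟨ cong ((1ℚ - s) +_) (tailsEscape-antipodal coin) ⟩
    (1ℚ - s) + (1ℚ - s) ^ℚ ∣ T ∣ ∎
    where
    open ≤-Reasoning
    X Y : ℚ
    X = tailsEscape coin
    Y = tailsEscape (λ j → not (coin j))
    X≤1 : X ≤ 1ℚ
    X≤1 = proj₂ (tailsEscape-InUnit s∈I coin)
  ... | false = begin
    1ℚ * X + (1ℚ - s) * Y  ≡⟨ solve 3 (λ r x y → con 1ℚ :* x :+ r :* y := r :* y :+ x) refl (1ℚ - s) X Y ⟩
    (1ℚ - s) * Y + X       ≤⟨ rx+y≤r+xy Y≤1 (tailsEscape-≤ s∈I coin i∈T coin-qi) ⟩
    (1ℚ - s) + Y * X       ≡⟨ cong ((1ℚ - s) +_) (trans (*-comm Y X) (tailsEscape-antipodal coin)) ⟩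
    (1ℚ - s) + (1ℚ - s) ^ℚ ∣ T ∣ ∎
    where
    open ≤-Reasoning
    X Y : ℚ
    X = tailsEscape coin
    Y = tailsEscape (λ j → not (coin j))
    Y≤1 : Y ≤ 1ℚ
    Y≤1 = proj₂ (tailsEscape-InUnit s∈I (λ j → not (coin j)))

Pr-avoidEvent : ∀ {n m} (q : Fin m → Fin n) (T : Subset m) p i′ →
                Pr n m p (avoidEvent q T i′) ≡
                sumBool n (λ coin → uniform n * Coins.avoid q T (p + p) coin i′)
Pr-avoidEvent {n} {m} q T p i′ = sumBool-cong n given-coins
  where
  open Bernoulli (p + p)
  open Coins q T (p + p)

  given-coins : ∀ coin →
    sumBool n (λ b₂ → sumBool m (λ b₃ → weight n m p coin b₂ b₃ * ind (avoidEvent q T i′ coin b₂ b₃)))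
    ≡ uniform n * avoid coin i′
  given-coins coin = begin
    sumBool n (λ b₂ → sumBool m (λ b₃ → (uniform n * (density n b₂ * density m b₃)) * ind (A b₂ ∧ B b₃)))
      ≡⟨ sumBool-cong n (λ b₂ → sumBool-cong m (λ b₃ → regroup b₂ b₃)) ⟩
    sumBool n (λ b₂ → sumBool m (λ b₃ → (uniform n * (density n b₂ * ind (A b₂))) * (density m b₃ * ind (B b₃))))
      ≡⟨ sumBool-*-sumBool n m _ _ ⟩
    sumBool n (λ b₂ → uniform n * (density n b₂ * ind (A b₂))) * expect m (λ b₃ → ind (B b₃))
      ≡⟨ cong (_* expect m (λ b₃ → ind (B b₃))) (sumBool-*ˡ n (uniform n) _) ⟩
    (uniform n * expect n (λ b₂ → ind (A b₂))) * expect m (λ b₃ → ind (B b₃))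
      ≡⟨ cong₂ (λ x y → (uniform n * x) * y) i′-escapes T-escapes ⟩
    (uniform n * escape (coin i′)) * tailsEscape coin
      ≡⟨ *-assoc (uniform n) _ _ ⟩
    uniform n * avoid coin i′ ∎
    where
    open ≡-Reasoning
    A : (Fin n → Bool) → Bool
    A b₂ = not (inS₂ coin b₂ i′)
    B : (Fin m → Bool) → Bool
    B b₃ = allFin m (λ k → not (lookup T k ∧ inS₃ q coin b₃ k))

    regroup : ∀ b₂ b₃ → (uniform n * (density n b₂ * density m b₃)) * ind (A b₂ ∧ B b₃) ≡
                        (uniform n * (density n b₂ * ind (A b₂))) * (density m b₃ * ind (B b₃))
    regroup b₂ b₃ = trans (cong (uniform n * (density n b₂ * density m b₃) *_) (ind-∧ (A b₂) (B b₃)))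
      (solve 5 (λ h a b x y → (h :* (a :* b)) :* (x :* y) := (h :* (a :* x)) :* (b :* y)) refl
         (uniform n) (density n b₂) (density m b₃) (ind (A b₂)) (ind (B b₃)))

    i′-escapes : expect n (λ b₂ → ind (A b₂)) ≡ escape (coin i′)
    i′-escapes = trans (expect-coordinate n i′ (λ b → ind (not (coin i′ ∧ b)))) (mean-escape (coin i′))

    T-escapes : expect m (λ b₃ → ind (B b₃)) ≡ tailsEscape coin
    T-escapes = begin
      expect m (λ b₃ → ind (B b₃))
        ≡⟨ sumBool-cong m (λ b₃ → cong (density m b₃ *_) (ind-allFin m _)) ⟩
      expect m (λ b₃ → prodFin m (λ k → ind (not (lookup T k ∧ (not (coin (q k)) ∧ b₃ k)))))
        ≡⟨ expect-prodFin m (λ k b → ind (not (lookup T k ∧ (not (coin (q k)) ∧ b)))) ⟩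
      prodFin m (λ k → mean (λ b → ind (not (lookup T k ∧ (not (coin (q k)) ∧ b)))))
        ≡⟨ prodFin-cong m (λ k → mean-escape-∧ (lookup T k) (not (coin (q k)))) ⟩
      tailsEscape coin ∎

proposition4p7 : (n m : ℕ) (q : Fin m → Fin n) (p : ℚ) → 0ℚ ≤ p → p ≤ ½ →
                 (T : Subset m) → Nonempty T → (c : ℕ) → ∣ T ∣ ≡ c →
                 (i : Fin m) → i ∈ T → (i' : Fin n) → i' ≡ q i →
                 Pr n m p (avoidEvent q T i') ≤ ½ * (1ℚ - (p + p)) + ½ * ((1ℚ - (p + p)) ^ℚ c)
proposition4p7 n m q p 0≤p p≤½ T _ c refl i i∈T i' refl = begin
  Pr n m p (avoidEvent q T (q i))                       ≡⟨ Pr-avoidEvent q T p (q i) ⟩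
  sumBool n (λ coin → uniform n * avoid coin (q i))    ≤⟨ uniform-antipodal-≤ n (λ coin → avoid coin (q i)) _
                                                            (avoid-ext (q i)) (avoid-antipodal-≤ 2p∈I ([]=⇒lookup i∈T)) ⟩
  ½ * (r + r ^ℚ ∣ T ∣)                                 ≡⟨ *-distribˡ-+ ½ r (r ^ℚ ∣ T ∣) ⟩
  ½ * r + ½ * r ^ℚ ∣ T ∣                               ∎
  where
  open ≤-Reasoning
  open Coins q T (p + p)
  r : ℚ
  r = 1ℚ - (p + p)

  2p∈I : InUnit (p + p)
  2p∈I = +-mono-≤ 0≤p 0≤p , +-mono-≤ p≤½ p≤½
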